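{- Let $A$ be an ordered partition of $V(\overrightarrow{C_4})$ with at most $3$ parts. Then $\mathcal A(A)$ is a non-trivial ultrahomogeneous system of partitions with $|\mathcal A(A)|\le 4$ if and only if $A$ is a partition of $V(\overrightarrow{C_4})$ into two independent sets of size $2$. In this case the permutation group induced by $\mathrm{Aut}(\overrightarrow{C_4})$ on $\mathcal A(A)$ is $\mathbb Z_2$ (acting on the two elements of $\mathcal A(A)$).
   Context: $\overrightarrow{C_4}$ is the directed 4-cycle on $\{1,2,3,4\}$ with arcs $(1,2),(2,3),(3,4),(4,1)$, regarded as a CCD with all vertices of one color and edge color $1$ on arcs and $0$ on other ordered pairs. For a CCD $G$ (vertex coloring $\chi_G$, edge coloring on ordered pairs of distinct vertices), ultrahomogeneity means every isomorphism between induced sub-CCDs extends to an automorphism. An ordered partition is a tuple $(P_1,\dots,P_k)$ of disjoint non-empty sets covering $V(G)$. For $\varphi\in\mathrm{Aut}(G)$, $\varphi(A)=(\varphi(P_1),\dots,\varphi(P_k))$, and $\mathcal A(A)=\{\varphi(A):\varphi\in\mathrm{Aut}(G)\}$. For ordered partitions $A_1,\dots,A_m$, $\chi_G(A_1,\dots,A_m)$ is the coloring $v\mapsto(\chi_G(v),i_1,\dots,i_m)$ where $v$ lies in the $i_j$-th part of $A_j$. $\mathcal A(A)$ is an ultrahomogeneous system of partitions if for every finite sequence $A_1,\dots,A_m$ in $\mathcal A(A)$ the CCD $G$ recolored by $\chi_G(A_1,\dots,A_m)$ is ultrahomogeneous; it is non-trivial if $|\mathcal A(A)|\ne 1$. 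-}

module Defs where

open import Data.Nat using (ℕ; zero; suc; _≤_)
open import Data.Fin using (Fin; toℕ; zero; suc; _≟_)
open import Data.Fin.Subset using (Subset; _∈_)
open import Data.Fin.Permutation using (Permutation′; _⟨$⟩ʳ_; _⟨$⟩ˡ_)
open import Data.List using (List; []; _∷_; _++_; tabulate; filter; length; allFin)
open import Data.Vec using (Vec)
import Data.Vec as Vec
open import Data.Product using (Σ; ∃; _×_; _,_)
open import Data.Sum using (_⊎_)
open import Relation.Nullary using (¬_)
open import Relation.Binary.PropositionalEquality using (_≡_; _≢_)

-- A CCD on vertex set Fin n: vertex colours (lists of naturals, so that
-- recolouring by tuples is possible) and edge colours on ordered pairs.
-- (The value of ecol on the diagonal is irrelevant: it is never used.)
record CCD (n : ℕ) : Set where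
  field
    vcol : Fin n → List ℕ
    ecol : Fin n → Fin n → ℕ
open CCD public

record Aut {n : ℕ} (G : CCD n) : Set where
  field
    perm : Permutation′ n
    pres-v : ∀ v → vcol G (perm ⟨$⟩ʳ v) ≡ vcol G v
    pres-e : ∀ u v → u ≢ v → ecol G (perm ⟨$⟩ʳ u) (perm ⟨$⟩ʳ v) ≡ ecol G u v
open Aut public

-- An isomorphism between induced sub-CCDs G[S] and G[f(S)]: a map f
-- injective on S, preserving vertex colours on S and edge colours on
-- distinct pairs from S (it is then a bijection S → f(S)).
record PartialIso {n : ℕ} (G : CCD n) : Set where
  field
    dom : Subset n
    fun : Fin n → Fin n
    inj : ∀ u v → u ∈ dom → v ∈ dom → fun u ≡ fun v → u ≡ v
    iso-v : ∀ v → v ∈ dom → vcol G (fun v) ≡ vcol G v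
    iso-e : ∀ u v → u ∈ dom → v ∈ dom → u ≢ v → ecol G (fun u) (fun v) ≡ ecol G u v
open PartialIso public

Ultrahomogeneous : {n : ℕ} → CCD n → Set
Ultrahomogeneous G =
  (f : PartialIso G) → Σ (Aut G) λ φ → ∀ v → v ∈ dom f → perm φ ⟨$⟩ʳ v ≡ fun f v

-- Ordered partition (P_0,…,P_{k-1}) of Fin n: part v = index of the part
-- containing v; every part non-empty.
record OPart (n : ℕ) : Set where
  field
    nparts : ℕ
    part : Fin n → Fin nparts
    nonempty : ∀ i → ∃ λ v → part v ≡ i
open OPart public

_≈P_ : {n : ℕ} → OPart n → OPart n → Set
A ≈P B = (nparts A ≡ nparts B) × (∀ v → toℕ (part A v) ≡ toℕ (part B v))

-- φ(A) = (φ(P_1),…,φ(P_k)): v ∈ φ(P_i) iff φ⁻¹(v) ∈ P_i.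
act : {n : ℕ} {G : CCD n} → Aut G → OPart n → OPart n
act φ A = record
  { nparts = nparts A
  ; part = λ v → part A (perm φ ⟨$⟩ˡ v)
  ; nonempty = λ i → helper i (nonempty A i)
  }
  where
  open import Data.Fin.Permutation using (inverseˡ)
  open import Relation.Binary.PropositionalEquality using (trans; cong)
  helper : ∀ i → (∃ λ v → part A v ≡ i) → ∃ λ w → part A (perm φ ⟨$⟩ˡ w) ≡ i
  helper i (v , e) = perm φ ⟨$⟩ʳ v , trans (cong (part A) (inverseˡ (perm φ))) e

InOrbit : {n : ℕ} (G : CCD n) → OPart n → OPart n → Set
InOrbit G A B = Σ (Aut G) λ φ → act φ A ≈P B

OrbitSize : {n : ℕ} (G : CCD n) → OPart n → ℕ → Set
OrbitSize G A m =
  Σ (Vec (Aut G) m) λ φs →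
    (∀ i j → ¬ i ≡ j → ¬ (act (Vec.lookup φs i) A ≈P act (Vec.lookup φs j) A)) ×
    (∀ (ψ : Aut G) → ∃ λ i → act ψ A ≈P act (Vec.lookup φs i) A)

recolor : {n m : ℕ} → CCD n → (Fin m → OPart n) → CCD n
recolor {n} G As = record
  { vcol = λ v → vcol G v ++ tabulate (λ j → toℕ (part (As j) v))
  ; ecol = ecol G
  }

UHSystem : {n : ℕ} (G : CCD n) → OPart n → Set
UHSystem {n} G A =
  ∀ (m : ℕ) (As : Fin m → OPart n) → (∀ j → InOrbit G A (As j)) →
    Ultrahomogeneous (recolor G As)

NontrivialUHSystemLe4 : {n : ℕ} (G : CCD n) → OPart n → Set
NontrivialUHSystemLe4 G A =
  UHSystem G A × (∃ λ m → OrbitSize G A m × ¬ m ≡ 1 × m ≤ 4)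

-- The directed 4-cycle on Fin 4 (vertices 0,1,2,3 for 1,2,3,4).
C4 : CCD 4
C4 = record { vcol = λ _ → 0 ∷ [] ; ecol = arc }
  where
  arc : Fin 4 → Fin 4 → ℕ
  arc zero (suc zero) = 1
  arc (suc zero) (suc (suc zero)) = 1
  arc (suc (suc zero)) (suc (suc (suc zero))) = 1
  arc (suc (suc (suc zero))) zero = 1
  arc _ _ = 0

partSize : {n : ℕ} (A : OPart n) → Fin (nparts A) → ℕ
partSize {n} A i = length (filter (λ v → part A v ≟ i) (allFin n))

TwoIndependentPairs : {n : ℕ} (G : CCD n) → OPart n → Set
TwoIndependentPairs G A =
  (nparts A ≡ 2) × (∀ i → partSize A i ≡ 2) ×
  (∀ u v → part A u ≡ part A v → u ≢ v → ecol G u v ≡ 0)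

-- The permutation group induced by Aut(G) on 𝒜(A) is ℤ₂ acting on the two
-- elements: |𝒜(A)| = 2, every automorphism acts on 𝒜(A) either as the
-- identity or fixed-point-freely (as the swap), and some automorphism
-- acts as the swap.
InducedZ2 : {n : ℕ} (G : CCD n) → OPart n → Set
InducedZ2 G A =
  OrbitSize G A 2 ×
  (∀ (ψ : Aut G) →
     (∀ B → InOrbit G A B → act ψ B ≈P B) ⊎
     (∀ B → InOrbit G A B → ¬ (act ψ B ≈P B))) ×
  (Σ (Aut G) λ ψ → ∀ B → InOrbit G A B → ¬ (act ψ B ≈P B))

{-# OPTIONS --safe #-}
-- Arcs force every automorphism φ of the directed 4-cycle to satisfy
-- φ (w + 1) = φ w + 1, so Aut(C4) is the rotation group ℤ/4.  If 𝒜(A) is an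
-- ultrahomogeneous system and A has at most 3 parts, two distinct vertices
-- share a part, and extending the partial isomorphism between them in the
-- recolouring by A gives a non-trivial rotation fixing A.  Hence A is
-- invariant under the half-turn, and non-triviality rules out a single
-- part, leaving {0,2},{1,3}.  Conversely, every member of the orbit of this
-- partition is a 2-periodic alternating colouring, fixed by the half-turn
-- and moved by the quarter-turns; and a partial isomorphism f of any
-- recolouring is realised by the rotation through f u − u, because the arcs
-- between two distinct vertices determine their difference.
module Submission where

open import Defs
open import Data.Nat as ℕ using (ℕ; _≤_; z≤n; s≤s)
open import Data.Nat.Properties using (1+n≢0)
open import Data.Fin using (Fin; zero; suc; toℕ; _≟_)
open import Data.Fin.Properties using (all?; toℕ-injective; pigeonhole; <⇒≢)
open import Data.Fin.Subset using (_∈_; ⁅_⁆)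
open import Data.Fin.Subset.Properties using (nonempty?; x∈⁅y⁆⇒x≡y; x∈⁅x⁆)
import Data.Fin.Permutation as Perm
open import Data.Fin.Permutation using (Permutation′; _⟨$⟩ʳ_; _⟨$⟩ˡ_; permutation; inverseʳ)
open import Data.List using (List; []; _∷_; filter; length; allFin)
open import Data.List.Properties using (filter-≐; ∷-injectiveˡ; ∷-injectiveʳ; tabulate-cong)
open import Data.Vec using (Vec; []; _∷_; lookup)
open import Data.Product using (Σ; ∃; _×_; _,_; proj₁; proj₂)
open import Data.Sum using (_⊎_; inj₁; inj₂; map)
open import Data.Empty using (⊥-elim)
open import Function using (_∘_)
open import Relation.Nullary using (¬_; yes; no)
open import Relation.Nullary.Decidable using (from-yes; ¬?; _→-dec_; _⊎-dec_)
open import Relation.Binary.PropositionalEquality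

pattern 0F = zero
pattern 1F = suc zero
pattern 2F = suc (suc zero)
pattern 3F = suc (suc (suc zero))

arc : Fin 4 → Fin 4 → ℕ
arc = ecol C4

next : Fin 4 → Fin 4
next 0F = 1F
next 1F = 2F
next 2F = 3F
next 3F = 0F

rot : Fin 4 → Fin 4 → Fin 4
rot 0F w = w
rot 1F w = next w
rot 2F w = next (next w)
rot 3F w = next (next (next w))

neg : Fin 4 → Fin 4
neg 0F = 0F
neg 1F = 3F
neg 2F = 2F
neg 3F = 1F

offset : Fin 4 → Fin 4 → Fin 4
offset u a = rot a (neg u)

arc-next : ∀ u → arc u (next u) ≡ 1
arc-next = from-yes (all? λ u → arc u (next u) ℕ.≟ 1)

≢-next : ∀ u → u ≢ next u
≢-next = from-yes (all? λ u → ¬? (u ≟ next u))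

arc≡0⊎next : ∀ u v → arc u v ≡ 0 ⊎ v ≡ next u
arc≡0⊎next = from-yes (all? λ u → all? λ v → arc u v ℕ.≟ 0 ⊎-dec v ≟ next u)

arc≡1⇒next : ∀ u v → arc u v ≡ 1 → v ≡ next u
arc≡1⇒next u v arc≡1 with arc≡0⊎next u v
... | inj₁ arc≡0 = ⊥-elim (1+n≢0 (trans (sym arc≡1) arc≡0))
... | inj₂ v≡next = v≡next

rot-arc : ∀ d u v → arc (rot d u) (rot d v) ≡ arc u v
rot-arc = from-yes (all? λ d → all? λ u → all? λ v → arc (rot d u) (rot d v) ℕ.≟ arc u v)

rot-neg-inverseˡ : ∀ d w → rot (neg d) (rot d w) ≡ w
rot-neg-inverseˡ = from-yes (all? λ d → all? λ w → rot (neg d) (rot d w) ≟ w)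

rot-neg-inverseʳ : ∀ d w → rot d (rot (neg d) w) ≡ w
rot-neg-inverseʳ = from-yes (all? λ d → all? λ w → rot d (rot (neg d) w) ≟ w)

rot-0F : ∀ k → rot k 0F ≡ k
rot-0F = from-yes (all? λ k → rot k 0F ≟ k)

rot-next : ∀ k w → rot k (next w) ≡ next (rot k w)
rot-next = from-yes (all? λ k → all? λ w → rot k (next w) ≟ next (rot k w))

rot-3F-3F : ∀ w → rot 3F (rot 3F w) ≡ rot 2F w
rot-3F-3F = from-yes (all? λ w → rot 3F (rot 3F w) ≟ rot 2F w)

rot-offset : ∀ u a → rot (offset u a) u ≡ a
rot-offset = from-yes (all? λ u → all? λ a → rot (offset u a) u ≟ a)

-- The arcs in both directions between u ≠ v determine v − u; hence b − a = v − u.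
arcs-determine-rotation : ∀ u v a b → u ≢ v → a ≢ b →
  arc a b ≡ arc u v → arc b a ≡ arc v u → b ≡ rot (offset u a) v
arcs-determine-rotation = from-yes (all? λ u → all? λ v → all? λ a → all? λ b →
  ¬? (u ≟ v) →-dec ¬? (a ≟ b) →-dec arc a b ℕ.≟ arc u v →-dec arc b a ℕ.≟ arc v u →-dec
  b ≟ rot (offset u a) v)

Periodic : {X : Set} → (Fin 4 → X) → Set
Periodic c = ∀ w → c (rot 2F w) ≡ c w

Alternating : {X : Set} → (Fin 4 → X) → Set
Alternating c = ∀ w → c (next w) ≢ c w

module _ {X : Set} {c : Fin 4 → X} (periodic : Periodic c) where

  periodic-adjacent⇒constant : ∀ u → c (next u) ≡ c u → ∀ w → c w ≡ c 0F
  periodic-adjacent⇒constant u same = constant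
    where
    c1≡c0 : ∀ u → c (next u) ≡ c u → c 1F ≡ c 0F
    c1≡c0 0F e = e
    c1≡c0 1F e = trans (sym e) (periodic 0F)
    c1≡c0 2F e = trans (sym (periodic 1F)) (trans e (periodic 0F))
    c1≡c0 3F e = trans (sym (periodic 1F)) (sym e)

    constant : ∀ w → c w ≡ c 0F
    constant 0F = refl
    constant 1F = c1≡c0 u same
    constant 2F = periodic 0F
    constant 3F = trans (periodic 1F) (c1≡c0 u same)

  periodic-distinct⇒alternating : c 0F ≢ c 1F → Alternating c
  periodic-distinct⇒alternating c0≢c1 w same =
    c0≢c1 (sym (periodic-adjacent⇒constant w same 1F))

  -- For odd d the hypothesis makes two adjacent colours equal, so c is constant.
  periodic-invariant-at⇒invariant : ∀ d u → c (rot d u) ≡ c u → ∀ w → c (rot d w) ≡ c w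
  periodic-invariant-at⇒invariant 0F u _ w = refl
  periodic-invariant-at⇒invariant 2F u _ w = periodic w
  periodic-invariant-at⇒invariant 1F u same w = trans (constant (next w)) (sym (constant w))
    where constant = periodic-adjacent⇒constant u same
  periodic-invariant-at⇒invariant 3F u same w = trans (constant (rot 3F w)) (sym (constant w))
    where constant = periodic-adjacent⇒constant u (trans (sym (periodic (next u))) same)

  periodic-alternating⇒rot-3F-moves : Alternating c → ∀ w → c (rot 3F w) ≢ c w
  periodic-alternating⇒rot-3F-moves alternating w same =
    alternating w (trans (sym (periodic (next w))) same)

  periodic-∘rot : ∀ k → Periodic (c ∘ rot k)
  periodic-∘rot k w =
    trans (cong c (trans (rot-next k (next w)) (cong next (rot-next k w)))) (periodic (rot k w))

moving-rotation-invariant⇒periodic : {X : Set} {c : Fin 4 → X} → ∀ k u → rot k u ≢ u →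
  (∀ w → c (rot k w) ≡ c w) → Periodic c
moving-rotation-invariant⇒periodic 0F u moves _ = ⊥-elim (moves refl)
moving-rotation-invariant⇒periodic 1F u _ invariant w = trans (invariant (next w)) (invariant w)
moving-rotation-invariant⇒periodic 2F u _ invariant = invariant
moving-rotation-invariant⇒periodic {c = c} 3F u _ invariant w =
  trans (cong c (sym (rot-3F-3F w))) (trans (invariant (rot 3F w)) (invariant w))

alternating-∘rot : {X : Set} {c : Fin 4 → X} → Alternating c → ∀ k → Alternating (c ∘ rot k)
alternating-∘rot {c = c} alternating k w same =
  alternating (rot k w) (trans (cong c (sym (rot-next k w))) same)

periodic-resp : {X : Set} {c c′ : Fin 4 → X} → c ≗ c′ → Periodic c → Periodic c′
periodic-resp c≗c′ periodic w = trans (sym (c≗c′ _)) (trans (periodic w) (c≗c′ w))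

alternating-resp : {X : Set} {c c′ : Fin 4 → X} → c ≗ c′ → Alternating c → Alternating c′
alternating-resp c≗c′ alternating w same =
  alternating w (trans (c≗c′ (next w)) (trans same (sym (c≗c′ w))))

alternating-toℕ : ∀ {n} {c : Fin 4 → Fin n} → Alternating c → Alternating (toℕ ∘ c)
alternating-toℕ alternating w = alternating w ∘ toℕ-injective

alternating⇒independent : {X : Set} {c : Fin 4 → X} → Alternating c →
  ∀ u v → c u ≡ c v → arc u v ≡ 0
alternating⇒independent alternating u v same with arc≡0⊎next u v
... | inj₁ arc≡0 = arc≡0
... | inj₂ refl = ⊥-elim (alternating u (sym same))

independent⇒alternating : {X : Set} {c : Fin 4 → X} →
  (∀ u v → c u ≡ c v → u ≢ v → arc u v ≡ 0) → Alternating c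
independent⇒alternating independent w same =
  1+n≢0 (trans (sym (arc-next w)) (independent w (next w) (sym same) (≢-next w)))

≢-≢⇒≡ : {a b c : Fin 2} → a ≢ b → b ≢ c → a ≡ c
≢-≢⇒≡ {0F} {1F} {0F} _ _ = refl
≢-≢⇒≡ {1F} {0F} {1F} _ _ = refl
≢-≢⇒≡ {0F} {0F} a≢b _ = ⊥-elim (a≢b refl)
≢-≢⇒≡ {1F} {1F} a≢b _ = ⊥-elim (a≢b refl)
≢-≢⇒≡ {_} {0F} {0F} _ b≢c = ⊥-elim (b≢c refl)
≢-≢⇒≡ {_} {1F} {1F} _ b≢c = ⊥-elim (b≢c refl)

two-colour-alternating⇒periodic : ∀ {n} → n ≡ 2 → (c : Fin 4 → Fin n) → Alternating c → Periodic c
two-colour-alternating⇒periodic refl c alternating w = ≢-≢⇒≡ (alternating (next w)) (alternating w)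

identityAut : ∀ {n} (G : CCD n) → Aut G
identityAut G = record { perm = Perm.id ; pres-v = λ _ → refl ; pres-e = λ _ _ _ → refl }

inOrbit-refl : ∀ {n} (G : CCD n) (A : OPart n) → InOrbit G A A
inOrbit-refl G A = identityAut G , refl , λ _ → refl

constant⇒orbitSize≡1 : ∀ {n m} (G : CCD n) (A : OPart n) →
  (∀ u v → part A u ≡ part A v) → OrbitSize G A m → m ≡ 1
constant⇒orbitSize≡1 {m = 0} G _ _ (_ , _ , exhaustive) with () ← proj₁ (exhaustive (identityAut G))
constant⇒orbitSize≡1 {m = 1} _ _ _ _ = refl
constant⇒orbitSize≡1 {m = ℕ.suc (ℕ.suc _)} _ _ constant (_ , distinct , _) =
  ⊥-elim (distinct 0F 1F (λ ()) (refl , λ v → cong toℕ (constant _ _)))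

singletonIso : ∀ {n} (G : CCD n) {u v} → vcol G u ≡ vcol G v → PartialIso G
singletonIso G {u} {v} same = record
  { dom = ⁅ u ⁆
  ; fun = λ _ → v
  ; inj = λ a b a∈ b∈ _ → trans (x∈⁅y⁆⇒x≡y u a∈) (sym (x∈⁅y⁆⇒x≡y u b∈))
  ; iso-v = λ w w∈ → trans (sym same) (cong (vcol G) (sym (x∈⁅y⁆⇒x≡y u w∈)))
  ; iso-e = λ a b a∈ b∈ a≢b → ⊥-elim (a≢b (trans (x∈⁅y⁆⇒x≡y u a∈) (sym (x∈⁅y⁆⇒x≡y u b∈))))
  }

ultrahomogeneous⇒transitive : ∀ {n} {G : CCD n} → Ultrahomogeneous G →
  ∀ {u v} → vcol G u ≡ vcol G v → Σ (Aut G) λ φ → perm φ ⟨$⟩ʳ u ≡ v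
ultrahomogeneous⇒transitive {G = G} uh {u} same with φ , extends ← uh (singletonIso G same) =
  φ , extends u (x∈⁅x⁆ u)

colouredC4 : (Fin 4 → List ℕ) → CCD 4
colouredC4 c = record { vcol = c ; ecol = arc }

rotation : Fin 4 → Permutation′ 4
rotation d = permutation (rot d) (rot (neg d)) (rot-neg-inverseʳ d) (rot-neg-inverseˡ d)

rotationAut : ∀ {c} d → (∀ w → c (rot d w) ≡ c w) → Aut (colouredC4 c)
rotationAut d invariant =
  record { perm = rotation d ; pres-v = invariant ; pres-e = λ u v _ → rot-arc d u v }

ArcPreserving : Permutation′ 4 → Set
ArcPreserving π = ∀ u v → u ≢ v → arc (π ⟨$⟩ʳ u) (π ⟨$⟩ʳ v) ≡ arc u v

arcPreserving⇒rotation : ∀ π → ArcPreserving π → ∀ w → π ⟨$⟩ʳ w ≡ rot (π ⟨$⟩ʳ 0F) w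
arcPreserving⇒rotation π preserves = go
  where
  k = π ⟨$⟩ʳ 0F

  base : π ⟨$⟩ʳ 0F ≡ rot k 0F
  base = sym (rot-0F k)

  step : ∀ {w} → π ⟨$⟩ʳ w ≡ rot k w → π ⟨$⟩ʳ next w ≡ rot k (next w)
  step {w} πw≡ = begin
    π ⟨$⟩ʳ next w      ≡⟨ arc≡1⇒next _ _ (trans (preserves w (next w) (≢-next w)) (arc-next w)) ⟩
    next (π ⟨$⟩ʳ w)    ≡⟨ cong next πw≡ ⟩
    next (rot k w)     ≡⟨ rot-next k w ⟨
    rot k (next w)     ∎
    where open ≡-Reasoning

  go : ∀ w → π ⟨$⟩ʳ w ≡ rot k w
  go 0F = base
  go 1F = step base
  go 2F = step (step base)
  go 3F = step (step (step base))

flip-arcPreserving : ∀ π → ArcPreserving π → ArcPreserving (Perm.flip π)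
flip-arcPreserving π preserves u v u≢v =
  trans (sym (preserves (π ⟨$⟩ˡ u) (π ⟨$⟩ˡ v) (u≢v ∘ injective)))
        (cong₂ arc (inverseʳ π) (inverseʳ π))
  where
  injective : π ⟨$⟩ˡ u ≡ π ⟨$⟩ˡ v → u ≡ v
  injective e = trans (sym (inverseʳ π)) (trans (cong (π ⟨$⟩ʳ_) e) (inverseʳ π))

arcPreserving⇒inverse-rotation : ∀ π → ArcPreserving π → ∀ w → π ⟨$⟩ˡ w ≡ rot (π ⟨$⟩ˡ 0F) w
arcPreserving⇒inverse-rotation π preserves =
  arcPreserving⇒rotation (Perm.flip π) (flip-arcPreserving π preserves)

aut-inverse-rotation : (φ : Aut C4) → ∀ w → perm φ ⟨$⟩ˡ w ≡ rot (perm φ ⟨$⟩ˡ 0F) w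
aut-inverse-rotation φ = arcPreserving⇒inverse-rotation (perm φ) (pres-e φ)

periodic⇒ultrahomogeneous : (c : Fin 4 → List ℕ) → Periodic c → Ultrahomogeneous (colouredC4 c)
periodic⇒ultrahomogeneous c periodic f with nonempty? (dom f)
... | no empty = rotationAut 0F (λ _ → refl) , λ v v∈ → ⊥-elim (empty (v , v∈))
... | yes (u , u∈) = rotationAut d (periodic-invariant-at⇒invariant periodic d u fixes-u) , agrees
  where
  d = offset u (fun f u)

  fixes-u : c (rot d u) ≡ c u
  fixes-u = trans (cong c (rot-offset u (fun f u))) (iso-v f u u∈)

  agrees : ∀ v → v ∈ dom f → rot d v ≡ fun f v
  agrees v v∈ with v ≟ u
  ... | yes refl = rot-offset u (fun f u)
  ... | no v≢u = sym (arcs-determine-rotation u v (fun f u) (fun f v) (v≢u ∘ sym)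
                        (v≢u ∘ sym ∘ inj f u v u∈ v∈)
                        (iso-e f u v u∈ v∈ (v≢u ∘ sym)) (iso-e f v u v∈ u∈ v≢u))

twoValued⇒≡2 : ∀ {n} {a b : Fin n} → (∀ i → i ≡ a ⊎ i ≡ b) → a ≢ b → n ≡ 2
twoValued⇒≡2 {1} {0F} {0F} _ a≢b = ⊥-elim (a≢b refl)
twoValued⇒≡2 {2} _ _ = refl
twoValued⇒≡2 {ℕ.suc (ℕ.suc (ℕ.suc _))} cover _ with cover 0F | cover 1F | cover 2F
... | inj₁ refl | inj₁ ()   | _
... | inj₁ refl | inj₂ refl | inj₁ ()
... | inj₁ refl | inj₂ refl | inj₂ ()
... | inj₂ refl | inj₁ refl | inj₁ ()
... | inj₂ refl | inj₁ refl | inj₂ ()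
... | inj₂ refl | inj₂ ()   | _

periodic-surjective⇒twoValued : ∀ {n} (p : Fin 4 → Fin n) → Periodic p →
  (∀ i → ∃ λ v → p v ≡ i) → ∀ i → i ≡ p 0F ⊎ i ≡ p 1F
periodic-surjective⇒twoValued p periodic onto i with onto i
... | 0F , refl = inj₁ refl
... | 1F , refl = inj₂ refl
... | 2F , refl = inj₁ (periodic 0F)
... | 3F , refl = inj₂ (periodic 1F)

alternatingColouring : {X : Set} → X → X → Fin 4 → X
alternatingColouring a b 0F = a
alternatingColouring a b 1F = b
alternatingColouring a b 2F = a
alternatingColouring a b 3F = b

periodic⇒alternatingColouring : {X : Set} {c : Fin 4 → X} → Periodic c →
  c ≗ alternatingColouring (c 0F) (c 1F)
periodic⇒alternatingColouring periodic 0F = refl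
periodic⇒alternatingColouring periodic 1F = refl
periodic⇒alternatingColouring periodic 2F = periodic 0F
periodic⇒alternatingColouring periodic 3F = periodic 1F

alternatingColouring-partSize≡2 : ∀ (a b i : Fin 2) → a ≢ b →
  length (filter (λ v → alternatingColouring a b v ≟ i) (allFin 4)) ≡ 2
alternatingColouring-partSize≡2 = from-yes (all? λ (a : Fin 2) → all? λ (b : Fin 2) → all? λ (i : Fin 2) →
  ¬? (a ≟ b) →-dec length (filter (λ v → alternatingColouring a b v ≟ i) (allFin 4)) ℕ.≟ 2)

periodic⇒partSize≡2 : (p : Fin 4 → Fin 2) → Periodic p → p 0F ≢ p 1F →
  ∀ i → length (filter (λ v → p v ≟ i) (allFin 4)) ≡ 2
periodic⇒partSize≡2 p periodic p0≢p1 i = begin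
  length (filter (λ v → p v ≟ i) (allFin 4))
    ≡⟨ cong length (filter-≐ (λ v → p v ≟ i) (λ v → alternatingColouring (p 0F) (p 1F) v ≟ i)
                          ((λ {v} → trans (sym (p≗ v))) , (λ {v} → trans (p≗ v))) (allFin 4)) ⟩
  length (filter (λ v → alternatingColouring (p 0F) (p 1F) v ≟ i) (allFin 4))
    ≡⟨ alternatingColouring-partSize≡2 (p 0F) (p 1F) i p0≢p1 ⟩
  2 ∎
  where
  open ≡-Reasoning
  p≗ = periodic⇒alternatingColouring periodic

periodic⇒twoIndependentPairs : (A : OPart 4) → Periodic (part A) → part A 0F ≢ part A 1F →
  TwoIndependentPairs C4 A
periodic⇒twoIndependentPairs record { part = p ; nonempty = onto } periodic p0≢p1
  with refl ← twoValued⇒≡2 (periodic-surjective⇒twoValued p periodic onto) p0≢p1 =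
  refl , periodic⇒partSize≡2 p periodic p0≢p1 ,
  λ u v pu≡pv _ → alternating⇒independent (periodic-distinct⇒alternating periodic p0≢p1) u v pu≡pv

recolouringAut-moving⇒periodic : (A : OPart 4) (φ : Aut (recolor C4 (λ (_ : Fin 1) → A))) →
  ∀ {u} → perm φ ⟨$⟩ʳ u ≢ u → Periodic (part A)
recolouringAut-moving⇒periodic A φ {u} moves =
  moving-rotation-invariant⇒periodic (perm φ ⟨$⟩ʳ 0F) u (moves ∘ trans (rotates u)) invariant
  where
  rotates = arcPreserving⇒rotation (perm φ) (pres-e φ)

  invariant : ∀ w → part A (rot (perm φ ⟨$⟩ʳ 0F) w) ≡ part A w
  invariant w = trans (cong (part A) (sym (rotates w)))
                      (toℕ-injective (∷-injectiveˡ (∷-injectiveʳ (pres-v φ w))))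

uhSystem-sharedPart⇒periodic : (A : OPart 4) → UHSystem C4 A →
  ∀ {u v} → u ≢ v → part A u ≡ part A v → Periodic (part A)
uhSystem-sharedPart⇒periodic A uh u≢v pu≡pv
  with φ , φu≡v ← ultrahomogeneous⇒transitive (uh 1 (λ _ → A) (λ _ → inOrbit-refl C4 A))
                                              (cong (λ i → 0 ∷ toℕ i ∷ []) pu≡pv) =
  recolouringAut-moving⇒periodic A φ (λ φu≡u → u≢v (trans (sym φu≡u) φu≡v))

nontrivialUHSystem⇒twoIndependentPairs : (A : OPart 4) → nparts A ≤ 3 →
  NontrivialUHSystemLe4 C4 A → TwoIndependentPairs C4 A
nontrivialUHSystem⇒twoIndependentPairs A ≤3 (uh , m , size , m≢1 , _)
  with u , v , u<v , pu≡pv ← pigeonhole (s≤s ≤3) (part A)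
  with periodic ← uhSystem-sharedPart⇒periodic A uh (<⇒≢ u<v) pu≡pv
  with part A 0F ≟ part A 1F
... | no p0≢p1 = periodic⇒twoIndependentPairs A periodic p0≢p1
... | yes p0≡p1 =
  ⊥-elim (m≢1 (constant⇒orbitSize≡1 C4 A (λ x y → trans (constant x) (sym (constant y))) size))
  where constant = periodic-adjacent⇒constant periodic 0F (sym p0≡p1)

module TwoIndependentPairsOrbit (A : OPart 4) (pairs : TwoIndependentPairs C4 A) where

  alternating : Alternating (part A)
  alternating = independent⇒alternating (proj₂ (proj₂ pairs))

  periodic : Periodic (part A)
  periodic = two-colour-alternating⇒periodic (proj₁ pairs) (part A) alternating

  member-rotated : ∀ B → InOrbit C4 A B → ∃ λ k → toℕ ∘ part A ∘ rot k ≗ toℕ ∘ part B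
  member-rotated B (φ , _ , φA≈B) =
    perm φ ⟨$⟩ˡ 0F , λ v → trans (cong (toℕ ∘ part A) (sym (aut-inverse-rotation φ v))) (φA≈B v)

  member-periodic : ∀ B → InOrbit C4 A B → Periodic (toℕ ∘ part B)
  member-periodic B B∈ with k , rotated ← member-rotated B B∈ =
    periodic-resp rotated (periodic-∘rot (cong toℕ ∘ periodic) k)

  member-alternating : ∀ B → InOrbit C4 A B → Alternating (toℕ ∘ part B)
  member-alternating B B∈ with k , rotated ← member-rotated B B∈ =
    alternating-resp rotated (alternating-∘rot (alternating-toℕ alternating) k)

  rot-3F-moves-members : ∀ B → InOrbit C4 A B → ∀ v → toℕ (part B (rot 3F v)) ≢ toℕ (part B v)
  rot-3F-moves-members B B∈ =
    periodic-alternating⇒rot-3F-moves (member-periodic B B∈) (member-alternating B B∈)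

  uhSystem : UHSystem C4 A
  uhSystem m As members = periodic⇒ultrahomogeneous _
    (λ w → cong (0 ∷_) (tabulate-cong (λ j → member-periodic (As j) (members j) w)))

  quarterTurn : Aut C4
  quarterTurn = rotationAut 1F (λ _ → refl)

  representatives : Vec (Aut C4) 2
  representatives = identityAut C4 ∷ quarterTurn ∷ []

  orbitSize≡2 : OrbitSize C4 A 2
  orbitSize≡2 = representatives , distinct , exhaustive
    where
    moves = rot-3F-moves-members A (inOrbit-refl C4 A)

    distinct : ∀ i j → i ≢ j →
      ¬ (act (lookup representatives i) A ≈P act (lookup representatives j) A)
    distinct 0F 0F i≢j = ⊥-elim (i≢j refl)
    distinct 1F 1F i≢j = ⊥-elim (i≢j refl)
    distinct 0F 1F _ (_ , same) = moves 0F (sym (same 0F))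
    distinct 1F 0F _ (_ , same) = moves 0F (same 0F)

    classify : (ψ : Aut C4) (k : Fin 4) → (∀ v → perm ψ ⟨$⟩ˡ v ≡ rot k v) →
      ∃ λ i → act ψ A ≈P act (lookup representatives i) A
    classify ψ 0F rotates = 0F , refl , λ v → cong (toℕ ∘ part A) (rotates v)
    classify ψ 2F rotates = 0F , refl , λ v → cong toℕ (trans (cong (part A) (rotates v)) (periodic v))
    classify ψ 3F rotates = 1F , refl , λ v → cong (toℕ ∘ part A) (rotates v)
    classify ψ 1F rotates =
      1F , refl , λ v → cong toℕ (trans (cong (part A) (rotates v)) (sym (periodic (next v))))

    exhaustive : (ψ : Aut C4) → ∃ λ i → act ψ A ≈P act (lookup representatives i) A
    exhaustive ψ = classify ψ (perm ψ ⟨$⟩ˡ 0F) (aut-inverse-rotation ψ)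

  rotation-action : ∀ k →
    (∀ B → InOrbit C4 A B → ∀ v → toℕ (part B (rot k v)) ≡ toℕ (part B v)) ⊎
    (∀ B → InOrbit C4 A B → ∀ v → toℕ (part B (rot k v)) ≢ toℕ (part B v))
  rotation-action 0F = inj₁ λ _ _ _ → refl
  rotation-action 1F = inj₂ member-alternating
  rotation-action 2F = inj₁ member-periodic
  rotation-action 3F = inj₂ rot-3F-moves-members

  action-on-orbit : (ψ : Aut C4) →
    (∀ B → InOrbit C4 A B → act ψ B ≈P B) ⊎ (∀ B → InOrbit C4 A B → ¬ (act ψ B ≈P B))
  action-on-orbit ψ = map
    (λ fixes B B∈ → refl , λ v → trans (cong (toℕ ∘ part B) (rotates v)) (fixes B B∈ v))
    (λ moves B B∈ (_ , same) →
      moves B B∈ 0F (trans (cong (toℕ ∘ part B) (sym (rotates 0F))) (same 0F)))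
    (rotation-action (perm ψ ⟨$⟩ˡ 0F))
    where rotates = aut-inverse-rotation ψ

  nontrivialUHSystem : NontrivialUHSystemLe4 C4 A
  nontrivialUHSystem = uhSystem , 2 , orbitSize≡2 , (λ ()) , s≤s (s≤s z≤n)

  inducedZ2 : InducedZ2 C4 A
  inducedZ2 = orbitSize≡2 , action-on-orbit ,
              quarterTurn , λ B B∈ (_ , same) → rot-3F-moves-members B B∈ 0F (same 0F)

mainTheorem10 : (A : OPart 4) → nparts A ≤ 3 →
    (NontrivialUHSystemLe4 C4 A → TwoIndependentPairs C4 A) ×
    (TwoIndependentPairs C4 A → NontrivialUHSystemLe4 C4 A) ×
    (TwoIndependentPairs C4 A → InducedZ2 C4 A)
mainTheorem10 A ≤3 =
  nontrivialUHSystem⇒twoIndependentPairs A ≤3 ,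
  TwoIndependentPairsOrbit.nontrivialUHSystem A ,
  TwoIndependentPairsOrbit.inducedZ2 A
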